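{- For all~$i>1$, either node~$i$ is the root of~$T_{i-1}$ or~$i-1$ is the root and~$i$ is the leftmost node of the root's right subtree.
   Context: BST model: an $n$-node BST on keys $\{1,\dots,n\}$; the $i$-th search for $s_i$ accesses a subtree $\tau_i$ containing the root and $s_i$ (the search path) and reconfigures it into a tree $\tau'_i$ on the same nodes. GreedyFuture is the offline BST algorithm that touches only the search path $\tau_i$ and then rearranges it: if $s_{i+1}\in\tau_i$ it makes $s_{i+1}$ the root of $\tau'_i$; otherwise it makes the predecessor and successor of $s_{i+1}$ within $\tau_i$ the root and the root's right child (only one if the other does not exist); it then recursively arranges the remaining nodes less than / greater than these fixed nodes using the corresponding subsequences of future searches. Here GreedyFuture is run on the search sequence $S=\langle1,2,\dots,n\rangle$ starting from an arbitrary BST $T_0$, and $T_0,T_1,\dots,T_n$ are the resulting trees ($T_i$ is the tree after the $i$-th search). -}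

module Defs where

open import Data.Nat using (ℕ; zero; suc; _+_; _∸_; _<ᵇ_; _≡ᵇ_)
open import Data.Bool using (Bool; true; false; if_then_else_; not)
open import Data.List using (List; []; _∷_; _++_; [_]; length; filterᵇ; applyUpTo; head; last)
open import Data.Bool.ListAction using (any)
open import Data.Maybe using (Maybe; just; nothing)
open import Data.Product using (_×_; _,_; proj₁)

data Tree : Set where
  leaf : Tree
  node : Tree → ℕ → Tree → Tree

inorder : Tree → List ℕ
inorder leaf = []
inorder (node l k r) = inorder l ++ (k ∷ inorder r)

root : Tree → Maybe ℕ
root leaf = nothing
root (node _ k _) = just k

rightSubtree : Tree → Tree
rightSubtree leaf = leaf
rightSubtree (node _ _ r) = r

leftmost : Tree → Maybe ℕ
leftmost leaf = nothing
leftmost (node leaf k _) = just k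
leftmost (node l@(node _ _ _) _ _) = leftmost l

fromAfter : ℕ → ℕ → List ℕ
fromAfter a k = applyUpTo (λ j → suc (a + j)) k

keys : ℕ → List ℕ
keys n = fromAfter 0 n

IsBSTOn : ℕ → Tree → Set
IsBSTOn n t = inorder t ≡ keys n
  where open import Relation.Binary.PropositionalEquality using (_≡_)

-- Search path of s in t: the path nodes in key order, and the subtrees
-- hanging off the path, in key order (one more than the path nodes).
split : ℕ → Tree → List ℕ × List Tree
split s leaf = [] , [ leaf ]
split s (node l k r) with s <ᵇ k | k <ᵇ s
... | true  | _     with split s l
...   | P , H = P ++ [ k ] , H ++ [ r ]
split s (node l k r) | false | true with split s r
...   | P , H = k ∷ P , l ∷ H
split s (node l k r) | false | false = [ k ] , l ∷ r ∷ []

-- Replace the leaves of a tree, in in-order order, by the given subtrees.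
fill : Tree → List Tree → Tree × List Tree
fill leaf [] = leaf , []
fill leaf (h ∷ hs) = h , hs
fill (node l k r) hs with fill l hs
... | l' , hs₁ with fill r hs₁
...   | r' , hs₂ = node l' k r' , hs₂

below above : ℕ → List ℕ → List ℕ
below x = filterᵇ (λ y → y <ᵇ x)
above x = filterᵇ (λ y → x <ᵇ y)

-- GreedyFuture arrangement of the sorted node list P using the future
-- searches fut.  The first argument is fuel (length P suffices).
-- d is the arbitrary arrangement used when there are no future searches
-- relevant to the nodes being arranged.
arrange : (List ℕ → Tree) → ℕ → List ℕ → List ℕ → Tree
arrange d _ [] _ = leaf
arrange d zero P _ = d P
arrange d (suc f) P [] = d P
arrange d (suc f) P (x ∷ fut) =
  if any (λ y → y ≡ᵇ x) P
  then node (arrange d f (below x P) (below x fut)) x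
            (arrange d f (above x P) (above x fut))
  else pp (last (below x P)) (head (above x P))
  where
  sub : (ℕ → List ℕ → List ℕ) → ℕ → Tree
  sub g y = arrange d f (g y P) (g y fut)
  pp : Maybe ℕ → Maybe ℕ → Tree
  pp (just p) (just q) = node (sub below p) p (node leaf q (sub above q))
  pp (just p) nothing  = node (sub below p) p leaf
  pp nothing  (just q) = node leaf q (sub above q)
  pp nothing  nothing  = leaf

gfStep : (List ℕ → Tree) → Tree → ℕ → List ℕ → Tree
gfStep d t s fut with split s t
... | P , H = proj₁ (fill (arrange d (length P) P fut) H)

-- Trees T_0, T_1, ..., T_n of GreedyFuture on the search sequence 1,2,...,n
-- from initial tree T0.  (T i) is the tree after the i-th search.
GF : (List ℕ → Tree) → ℕ → Tree → ℕ → Tree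
GF d n T0 zero = T0
GF d n T0 (suc i) = gfStep d (GF d n T0 i) (suc i) (fromAfter (suc i) (n ∸ suc i))

module Submission where

open import Defs
open import Data.Nat using (ℕ; suc; _<_; _≤_; _∸_)
open import Data.List using (List)
open import Data.Maybe using (just)
open import Data.Product using (_×_)
open import Data.Sum using (_⊎_)
open import Relation.Binary.PropositionalEquality using (_≡_)

open import Data.Nat using (zero; _+_; _<ᵇ_; _≡ᵇ_; z≤n; s≤s)
open import Data.Nat.Properties
  using (<ᵇ⇒<; <⇒<ᵇ; ≡ᵇ⇒≡; ≡⇒≡ᵇ; <-cmp; <-trans; <-irrefl; <-asym; <⇒≤; <⇒≱; ≮⇒≥;
         ≤-refl; ≤-antisym; ≤-pred; suc-injective; +-identityʳ; m<n⇒m<1+n; m<n⇒0<n∸m)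
open import Data.Bool using (true; false; T; if_then_else_)
open import Data.Bool.ListAction using (any)
open import Data.List
  using ([]; _∷_; _++_; [_]; _∷ʳ_; length; drop; filterᵇ; head; last; initLast; _∷ʳ′_)
open import Data.List.Properties
  using (++-assoc; ++-identityʳ; length-++; drop-drop; filter-++; filter-all; filter-none)
open import Data.List.Relation.Unary.All as All using (All; []; _∷_)
open import Data.List.Relation.Unary.All.Properties as All using (All¬⇒¬Any)
open import Data.List.Relation.Unary.AllPairs using (AllPairs; []; _∷_)
open import Data.List.Relation.Unary.AllPairs.Properties using (applyUpTo⁺₁)
open import Data.List.Relation.Unary.Any as Any using (here; there)
open import Data.List.Relation.Unary.Any.Properties using (any⁺; any⁻)
open import Data.List.Relation.Binary.Sublist.Propositional using (_⊆_; []; _∷_; minimum)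
  renaming (_∷ʳ_ to skip)
open import Data.List.Relation.Binary.Sublist.Propositional.Properties using (++⁺ˡ; All-resp-⊆)
open import Data.List.Membership.Propositional using (_∈_)
open import Data.List.Membership.Propositional.Properties
  using (∈-++⁻; ∈-++⁺ˡ; ∈-++⁺ʳ; ∈-∃++; ∈-applyUpTo⁺)
open import Data.Maybe using (Maybe; nothing)
open import Data.Product using (_,_; proj₁; proj₂)
open import Data.Sum using (inj₁; inj₂) renaming (map to ⊎-map)
open import Data.Empty using (⊥-elim)
open import Data.Unit using (tt)
open import Function using (id)
open import Relation.Nullary using (¬_)
open import Relation.Nullary.Decidable using (T?)
open import Relation.Binary.Definitions using (tri<; tri≈; tri>)
open import Relation.Binary.PropositionalEquality using (refl; sym; trans; cong; cong₂; subst; module ≡-Reasoning)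

-- Write T = T_{i-2}; then T_{i-1} is obtained by searching
-- s = i-1 in T, with next search s+1 = i.  Two facts suffice:
--  (a) every GreedyFuture step preserves the in-order traversal, so every
--      T_m is a BST on {1,…,n};
--  (b) the search path P of s contains s, so after the step the root is
--      s+1 (if s+1 ∈ P) or the predecessor of s+1 in P, which is s itself.

Sorted : List ℕ → Set
Sorted = AllPairs _<_

sorted-⊆ : ∀ {xs ys} → xs ⊆ ys → Sorted ys → Sorted xs
sorted-⊆ []         []      = []
sorted-⊆ (skip y τ) (_ ∷ s) = sorted-⊆ τ s
sorted-⊆ (refl ∷ τ) (p ∷ s) = All-resp-⊆ τ p ∷ sorted-⊆ τ s

record SortedAround (k : ℕ) (xs ys : List ℕ) : Set where
  field
    sortedˡ : Sorted xs
    sortedʳ : Sorted ys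
    boundˡ  : All (_< k) xs
    boundʳ  : All (k <_) ys

sorted-around : ∀ xs {k ys} → Sorted (xs ++ k ∷ ys) → SortedAround k xs ys
sorted-around []       (pk ∷ s) = record { sortedˡ = [] ; sortedʳ = s ; boundˡ = [] ; boundʳ = pk }
sorted-around (x ∷ xs) (px ∷ s) = record
  { sortedˡ = All.++⁻ˡ xs px ∷ sortedˡ
  ; sortedʳ = sortedʳ
  ; boundˡ  = All.head (All.++⁻ʳ xs px) ∷ boundˡ
  ; boundʳ  = boundʳ
  }
  where open SortedAround (sorted-around xs s)

∈-left-of : ∀ {s k} xs ys → All (k <_) ys → s < k → s ∈ xs ++ k ∷ ys → s ∈ xs
∈-left-of xs ys ys>k s<k s∈ with ∈-++⁻ xs s∈
... | inj₁ s∈xs          = s∈xs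
... | inj₂ (here refl)   = ⊥-elim (<-irrefl refl s<k)
... | inj₂ (there s∈ys)  = ⊥-elim (<-asym s<k (All.lookup ys>k s∈ys))

∈-right-of : ∀ {s k} xs ys → All (_< k) xs → k < s → s ∈ xs ++ k ∷ ys → s ∈ ys
∈-right-of xs ys xs<k k<s s∈ with ∈-++⁻ xs s∈
... | inj₁ s∈xs          = ⊥-elim (<-asym k<s (All.lookup xs<k s∈xs))
... | inj₂ (here refl)   = ⊥-elim (<-irrefl refl k<s)
... | inj₂ (there s∈ys)  = s∈ys

below-cut : ∀ {x} L R → All (_< x) L → All (x ≤_) R → below x (L ++ R) ≡ L
below-cut {x} L R L<x R≥x = begin
  filterᵇ (_<ᵇ x) (L ++ R)                          ≡⟨ filter-++ P? L R ⟩
  filterᵇ (_<ᵇ x) L ++ filterᵇ (_<ᵇ x) R            ≡⟨ cong₂ _++_ (filter-all P? (All.map <⇒<ᵇ L<x)) (filter-none P? R≮x) ⟩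
  L ++ []                                           ≡⟨ ++-identityʳ L ⟩
  L                                                 ∎
  where
  open ≡-Reasoning
  P? = λ z → T? (z <ᵇ x)
  R≮x : All (λ z → ¬ T (z <ᵇ x)) R
  R≮x = All.map (λ x≤z t → <⇒≱ (<ᵇ⇒< _ x t) x≤z) R≥x

above-cut : ∀ {x} L R → All (_≤ x) L → All (x <_) R → above x (L ++ R) ≡ R
above-cut {x} L R L≤x R>x = begin
  filterᵇ (x <ᵇ_) (L ++ R)                          ≡⟨ filter-++ P? L R ⟩
  filterᵇ (x <ᵇ_) L ++ filterᵇ (x <ᵇ_) R            ≡⟨ cong₂ _++_ (filter-none P? L≯x) (filter-all P? (All.map <⇒<ᵇ R>x)) ⟩
  R                                                 ∎
  where
  open ≡-Reasoning
  P? = λ z → T? (x <ᵇ z)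
  L≯x : All (λ z → ¬ T (x <ᵇ z)) L
  L≯x = All.map (λ z≤x t → <⇒≱ (<ᵇ⇒< x _ t) z≤x) L≤x

below-at : ∀ A p B → Sorted (A ++ p ∷ B) → below p (A ++ p ∷ B) ≡ A
below-at A p B s = below-cut A (p ∷ B) boundˡ (≤-refl ∷ All.map <⇒≤ boundʳ)
  where open SortedAround (sorted-around A s)

above-at : ∀ A p B → Sorted (A ++ p ∷ B) → above p (A ++ p ∷ B) ≡ B
above-at A p B s = begin
  above p (A ++ p ∷ B)     ≡⟨ cong (above p) (sym (++-assoc A [ p ] B)) ⟩
  above p (A ∷ʳ p ++ B)    ≡⟨ above-cut (A ∷ʳ p) B (All.++⁺ (All.map <⇒≤ boundˡ) (≤-refl ∷ [])) boundʳ ⟩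
  B                        ∎
  where
  open ≡-Reasoning
  open SortedAround (sorted-around A s)

last-∷ʳ : ∀ (xs : List ℕ) x → last (xs ∷ʳ x) ≡ just x
last-∷ʳ []           x = refl
last-∷ʳ (_ ∷ [])     x = refl
last-∷ʳ (_ ∷ y ∷ xs) x = last-∷ʳ (y ∷ xs) x

predecessor-of-suc : ∀ {s P} → Sorted P → s ∈ P → last (below (suc s) P) ≡ just s
predecessor-of-suc {s} {P} sP s∈P with ∈-∃++ s∈P
... | A , B , refl = begin
  last (below (suc s) (A ++ s ∷ B))   ≡⟨ cong (λ Q → last (below (suc s) Q)) (sym (++-assoc A [ s ] B)) ⟩
  last (below (suc s) (A ∷ʳ s ++ B))  ≡⟨ cong last (below-cut (A ∷ʳ s) B A∷ʳs≤s boundʳ) ⟩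
  last (A ∷ʳ s)                       ≡⟨ last-∷ʳ A s ⟩
  just s                              ∎
  where
  open ≡-Reasoning
  open SortedAround (sorted-around A sP)
  A∷ʳs≤s : All (_< suc s) (A ∷ʳ s)
  A∷ʳs≤s = All.++⁺ (All.map m<n⇒m<1+n boundˡ) (≤-refl ∷ [])

successor-first : ∀ {s} ys → Sorted ys → All (s <_) ys → suc s ∈ ys → head ys ≡ just (suc s)
successor-first (y ∷ ys) _         _         (here refl) = refl
successor-first (y ∷ ys) (y< ∷ _) (s<y ∷ _) (there s+1∈ys) =
  ⊥-elim (<⇒≱ s<y (≤-pred (All.lookup y< s+1∈ys)))

-- Weaving a search path with the subtrees hanging off it, which describes
-- both split (the decomposition) and fill (the reassembly).

-- The in-order traversal of a tree whose path nodes are P (in key order)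
-- and whose hanging subtrees are H (in key order).
weave : List ℕ → List Tree → List ℕ
weave []       []       = []
weave []       (h ∷ _)  = inorder h
weave (p ∷ ps) []       = p ∷ weave ps []
weave (p ∷ ps) (h ∷ hs) = inorder h ++ p ∷ weave ps hs

path-⊆ : ∀ P H → P ⊆ weave P H
path-⊆ []       H        = minimum _
path-⊆ (p ∷ ps) []       = refl ∷ path-⊆ ps []
path-⊆ (p ∷ ps) (h ∷ hs) = ++⁺ˡ (inorder h) (refl ∷ path-⊆ ps hs)

weave-++ : ∀ xs k ys hs →
           weave (xs ++ k ∷ ys) hs ≡ weave xs hs ++ k ∷ weave ys (drop (suc (length xs)) hs)
weave-++ []       k ys []       = refl
weave-++ []       k ys (h ∷ hs) = refl
weave-++ (x ∷ xs) k ys []       = cong (x ∷_) (weave-++ xs k ys [])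
weave-++ (x ∷ xs) k ys (h ∷ hs) =
  trans (cong (λ w → inorder h ++ x ∷ w) (weave-++ xs k ys hs))
        (sym (++-assoc (inorder h) _ _))

weave-∷ʳ : ∀ P H k r → length H ≡ suc (length P) →
           weave (P ∷ʳ k) (H ∷ʳ r) ≡ weave P H ++ k ∷ inorder r
weave-∷ʳ []       (h ∷ [])     k r _   = refl
weave-∷ʳ []       (h ∷ _ ∷ _)  k r ()
weave-∷ʳ (p ∷ ps) (h ∷ hs)     k r len =
  trans (cong (λ w → inorder h ++ p ∷ w) (weave-∷ʳ ps hs k r (suc-injective len)))
        (sym (++-assoc (inorder h) _ _))

-- fill consumes one hanging subtree per leaf of the tree being filled ...
fill-rest : ∀ t hs → proj₂ (fill t hs) ≡ drop (suc (length (inorder t))) hs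
fill-rest leaf         []       = refl
fill-rest leaf         (h ∷ hs) = refl
fill-rest (node l k r) hs with fill l hs | fill-rest l hs
... | _ , hs₁ | rest₁ with fill r hs₁ | fill-rest r hs₁
... | _ , hs₂ | rest₂ = begin
  hs₂                                                                       ≡⟨ rest₂ ⟩
  drop (suc (length (inorder r))) hs₁                                       ≡⟨ cong (drop (suc (length (inorder r)))) rest₁ ⟩
  drop (suc (length (inorder r))) (drop (suc (length (inorder l))) hs)      ≡⟨ drop-drop (suc (length (inorder l))) _ hs ⟩
  drop (suc (length (inorder l)) + suc (length (inorder r))) hs             ≡⟨ cong (λ m → drop (suc m) hs) (sym (length-++ (inorder l))) ⟩
  drop (suc (length (inorder l ++ k ∷ inorder r))) hs                       ∎
  where open ≡-Reasoning

fill-inorder : ∀ t hs → inorder (proj₁ (fill t hs)) ≡ weave (inorder t) hs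
fill-inorder leaf         []       = refl
fill-inorder leaf         (h ∷ hs) = refl
fill-inorder (node l k r) hs with fill l hs | fill-inorder l hs | fill-rest l hs
... | _ , hs₁ | in₁ | rest₁ with fill r hs₁ | fill-inorder r hs₁
... | _ , _   | in₂ =
  trans (cong₂ (λ a b → a ++ k ∷ b) in₁ (trans in₂ (cong (weave (inorder r)) rest₁)))
        (sym (weave-++ (inorder l) k (inorder r) hs))

fill-root : ∀ t hs {k} → root t ≡ just k → root (proj₁ (fill t hs)) ≡ just k
fill-root (node l k r) hs refl with fill l hs
... | _ , hs₁ with fill r hs₁
... | _ = refl

Decomposes : Tree → List ℕ × List Tree → Set
Decomposes t (P , H) = weave P H ≡ inorder t × length H ≡ suc (length P)

split-decomposes : ∀ s t → Decomposes t (split s t)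
split-decomposes s leaf = refl , refl
split-decomposes s (node l k r) with s <ᵇ k | k <ᵇ s
... | true | _ with split s l | split-decomposes s l
...   | P , H | w , len =
  trans (weave-∷ʳ P H k r len) (cong (_++ k ∷ inorder r) w) ,
  trans (length-++ H) (trans (cong (_+ 1) len) (cong suc (sym (length-++ P))))
split-decomposes s (node l k r) | false | true with split s r | split-decomposes s r
...   | P , H | w , len = cong (λ w′ → inorder l ++ k ∷ w′) w , cong suc len
split-decomposes s (node l k r) | false | false = refl , refl

searched-on-path : ∀ s t → Sorted (inorder t) → s ∈ inorder t → s ∈ proj₁ (split s t)
searched-on-path s leaf _ ()
searched-on-path s (node l k r) st s∈t with s <ᵇ k in s<ᵇk | k <ᵇ s in k<ᵇs
... | true | _ with split s l
               | searched-on-path s l sortedˡ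
                   (∈-left-of (inorder l) (inorder r) boundʳ (<ᵇ⇒< s k (subst T (sym s<ᵇk) tt)) s∈t)
  where open SortedAround (sorted-around (inorder l) st)
...   | _ , _ | s∈P = ∈-++⁺ˡ s∈P
searched-on-path s (node l k r) st s∈t | false | true with split s r
               | searched-on-path s r sortedʳ
                   (∈-right-of (inorder l) (inorder r) boundˡ (<ᵇ⇒< k s (subst T (sym k<ᵇs) tt)) s∈t)
  where open SortedAround (sorted-around (inorder l) st)
...   | _ , _ | s∈P = there s∈P
searched-on-path s (node l k r) st s∈t | false | false =
  here (≤-antisym (≮⇒≥ (λ k<s → subst T k<ᵇs (<⇒<ᵇ k<s))) (≮⇒≥ (λ s<k → subst T s<ᵇk (<⇒<ᵇ s<k))))

data Cut (x : ℕ) : List ℕ → Set where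
  hit  : ∀ L R → All (_< x) L → All (x <_) R → Cut x (L ++ x ∷ R)
  miss : ∀ L R → All (_< x) L → All (x <_) R → Cut x (L ++ R)

cut : ∀ x P → Sorted P → Cut x P
cut x []       _          = miss [] [] [] []
cut x (y ∷ ys) (y< ∷ sys) with <-cmp y x
... | tri≈ _ refl _ = hit [] ys [] y<
... | tri> _ _ x<y  = miss [] (y ∷ ys) [] (x<y ∷ All.map (<-trans x<y) y<)
... | tri< y<x _ _ with cut x ys sys
...   | hit  L R L<x R>x = hit  (y ∷ L) R (y<x ∷ L<x) R>x
...   | miss L R L<x R>x = miss (y ∷ L) R (y<x ∷ L<x) R>x

if-true : ∀ {A : Set} {b} {u v : A} → T b → (if b then u else v) ≡ u
if-true {b = true} _ = refl

if-false : ∀ {A : Set} {b} {u v : A} → ¬ T b → (if b then u else v) ≡ v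
if-false {b = false} _  = refl
if-false {b = true}  ¬t = ⊥-elim (¬t tt)

module _ (d : List ℕ → Tree) where

  -- The tree built when the next search x misses P: the predecessor u and
  -- successor v of x in P become the root and its right child (this mirrors
  -- the local helper of arrange, which is not accessible outside Defs).
  gapTree : ℕ → List ℕ → List ℕ → Maybe ℕ → Maybe ℕ → Tree
  gapTree f P fut (just p) (just q) =
    node (arrange d f (below p P) (below p fut)) p (node leaf q (arrange d f (above q P) (above q fut)))
  gapTree f P fut (just p) nothing  = node (arrange d f (below p P) (below p fut)) p leaf
  gapTree f P fut nothing  (just q) = node leaf q (arrange d f (above q P) (above q fut))
  gapTree f P fut nothing  nothing  = leaf

  arrangeStep : ℕ → List ℕ → ℕ → List ℕ → Tree
  arrangeStep f P x fut =
    if any (_≡ᵇ x) P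
    then node (arrange d f (below x P) (below x fut)) x (arrange d f (above x P) (above x fut))
    else gapTree f P fut (last (below x P)) (head (above x P))

  arrange-unfold : ∀ f y ys x fut → arrange d (suc f) (y ∷ ys) (x ∷ fut) ≡ arrangeStep f (y ∷ ys) x fut
  arrange-unfold f y ys x fut with any (_≡ᵇ x) (y ∷ ys)
  ... | true  = refl
  ... | false with last (below x (y ∷ ys)) | head (above x (y ∷ ys))
  ...   | just _  | just _  = refl
  ...   | just _  | nothing = refl
  ...   | nothing | just _  = refl
  ...   | nothing | nothing = refl

  arrange-root : ∀ f y ys x fut {p} → last (below x (y ∷ ys)) ≡ just p →
                 root (arrange d (suc f) (y ∷ ys) (x ∷ fut)) ≡ just x
                 ⊎ root (arrange d (suc f) (y ∷ ys) (x ∷ fut)) ≡ just p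
  arrange-root f y ys x fut pred rewrite arrange-unfold f y ys x fut with any (_≡ᵇ x) (y ∷ ys)
  ... | true  = inj₁ refl
  ... | false rewrite pred with head (above x (y ∷ ys))
  ...   | just _  = inj₂ refl
  ...   | nothing = inj₂ refl

  module _ (f : ℕ) (IH : ∀ P fut → Sorted P → inorder (arrange d f P fut) ≡ P) where

    lower-inorder : ∀ {P} A p B fut → P ≡ A ++ p ∷ B → Sorted P →
                    inorder (arrange d f (below p P) (below p fut)) ≡ A
    lower-inorder A p B fut refl sP =
      trans (cong (λ Q → inorder (arrange d f Q (below p fut))) (below-at A p B sP))
            (IH A _ (SortedAround.sortedˡ (sorted-around A sP)))

    upper-inorder : ∀ {P} A p B fut → P ≡ A ++ p ∷ B → Sorted P →
                    inorder (arrange d f (above p P) (above p fut)) ≡ B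
    upper-inorder A p B fut refl sP =
      trans (cong (λ Q → inorder (arrange d f Q (above p fut))) (above-at A p B sP))
            (IH B _ (SortedAround.sortedʳ (sorted-around A sP)))

    gap-inorder : ∀ L R fut → Sorted (L ++ R) →
                  inorder (gapTree f (L ++ R) fut (last L) (head R)) ≡ L ++ R
    gap-inorder L R fut sP with initLast L | R
    ... | []        | []      = refl
    ... | []        | q ∷ R′  = cong (q ∷_) (upper-inorder [] q R′ fut refl sP)
    ... | L′ ∷ʳ′ p  | []      rewrite last-∷ʳ L′ p = begin
      inorder (arrange d f (below p P) (below p fut)) ++ [ p ]  ≡⟨ cong (_++ [ p ]) (lower-inorder L′ p [] fut (++-assoc L′ [ p ] []) sP) ⟩
      L′ ∷ʳ p                                                   ≡⟨ sym (++-identityʳ _) ⟩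
      L′ ∷ʳ p ++ []                                             ∎
      where
      open ≡-Reasoning
      P = L′ ∷ʳ p ++ []
    ... | L′ ∷ʳ′ p  | q ∷ R′  rewrite last-∷ʳ L′ p = begin
      inorder (arrange d f (below p P) (below p fut)) ++ p ∷ q ∷ inorder (arrange d f (above q P) (above q fut))
        ≡⟨ cong₂ (λ a b → a ++ p ∷ q ∷ b) (lower-inorder L′ p (q ∷ R′) fut (++-assoc L′ [ p ] (q ∷ R′)) sP)
                                         (upper-inorder (L′ ∷ʳ p) q R′ fut refl sP) ⟩
      L′ ++ p ∷ q ∷ R′
        ≡⟨ sym (++-assoc L′ [ p ] (q ∷ R′)) ⟩
      L′ ∷ʳ p ++ q ∷ R′ ∎
      where
      open ≡-Reasoning
      P = L′ ∷ʳ p ++ q ∷ R′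

    arrangeStep-inorder : ∀ P x fut → Sorted P → inorder (arrangeStep f P x fut) ≡ P
    arrangeStep-inorder P x fut sP with cut x P sP
    ... | hit L R _ _ =
      trans (cong inorder (if-true x-found))
            (cong₂ (λ a b → a ++ x ∷ b) (lower-inorder L x R fut refl sP) (upper-inorder L x R fut refl sP))
      where
      x-found : T (any (_≡ᵇ x) (L ++ x ∷ R))
      x-found = any⁺ _ (Any.map (λ { refl → ≡⇒≡ᵇ x x refl }) (∈-++⁺ʳ L (here refl)))
    ... | miss L R L<x R>x = begin
      inorder (arrangeStep f (L ++ R) x fut)
        ≡⟨ cong inorder (if-false (λ t → All¬⇒¬Any x∉ (any⁻ _ _ t))) ⟩
      inorder (gapTree f (L ++ R) fut (last (below x (L ++ R))) (head (above x (L ++ R))))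
        ≡⟨ cong₂ (λ u v → inorder (gapTree f (L ++ R) fut (last u) (head v)))
                 (below-cut L R L<x (All.map <⇒≤ R>x)) (above-cut L R (All.map <⇒≤ L<x) R>x) ⟩
      inorder (gapTree f (L ++ R) fut (last L) (head R))
        ≡⟨ gap-inorder L R fut sP ⟩
      L ++ R ∎
      where
      open ≡-Reasoning
      x∉ : All (λ z → ¬ T (z ≡ᵇ x)) (L ++ R)
      x∉ = All.++⁺ (All.map (λ z<x t → <-irrefl (≡ᵇ⇒≡ _ x t) z<x) L<x)
                   (All.map (λ x<z t → <-irrefl (sym (≡ᵇ⇒≡ _ x t)) x<z) R>x)

  arrange-inorder : (∀ xs → inorder (d xs) ≡ xs) →
                    ∀ f P fut → Sorted P → inorder (arrange d f P fut) ≡ P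
  arrange-inorder d-inorder f       []       fut       _  = refl
  arrange-inorder d-inorder zero    (y ∷ ys) fut       _  = d-inorder _
  arrange-inorder d-inorder (suc f) (y ∷ ys) []        _  = d-inorder _
  arrange-inorder d-inorder (suc f) (y ∷ ys) (x ∷ fut) sP =
    trans (cong inorder (arrange-unfold f y ys x fut))
          (arrangeStep-inorder f (arrange-inorder d-inorder f) (y ∷ ys) x fut sP)

keys-sorted : ∀ n → Sorted (keys n)
keys-sorted n = applyUpTo⁺₁ _ n (λ i<j _ → s≤s i<j)

bst-sorted : ∀ {n} t → IsBSTOn n t → Sorted (inorder t)
bst-sorted {n} _ t-bst = subst Sorted (sym t-bst) (keys-sorted n)

module _ (d : List ℕ → Tree) where

  gfStep-inorder : (∀ xs → inorder (d xs) ≡ xs) → ∀ t s fut → Sorted (inorder t) →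
                   inorder (gfStep d t s fut) ≡ inorder t
  gfStep-inorder d-inorder t s fut st with split s t | split-decomposes s t
  ... | P , H | w , _ = begin
    inorder (proj₁ (fill (arrange d (length P) P fut) H))  ≡⟨ fill-inorder (arrange d (length P) P fut) H ⟩
    weave (inorder (arrange d (length P) P fut)) H         ≡⟨ cong (λ Q → weave Q H) (arrange-inorder d d-inorder _ P fut sP) ⟩
    weave P H                                              ≡⟨ w ⟩
    inorder t                                              ∎
    where
    open ≡-Reasoning
    sP : Sorted P
    sP = sorted-⊆ (path-⊆ P H) (subst Sorted (sym w) st)

  GF-inorder : (∀ xs → inorder (d xs) ≡ xs) → ∀ n T0 → IsBSTOn n T0 → ∀ j → IsBSTOn n (GF d n T0 j)
  GF-inorder d-inorder n T0 T0-bst zero    = T0-bst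
  GF-inorder d-inorder n T0 T0-bst (suc j) =
    trans (gfStep-inorder d-inorder (GF d n T0 j) _ _ (bst-sorted (GF d n T0 j) T-bst)) T-bst
    where
    T-bst : IsBSTOn n (GF d n T0 j)
    T-bst = GF-inorder d-inorder n T0 T0-bst j

  gfStep-root : ∀ t s fut → head fut ≡ just (suc s) → Sorted (inorder t) → s ∈ inorder t →
                root (gfStep d t s fut) ≡ just (suc s) ⊎ root (gfStep d t s fut) ≡ just s
  gfStep-root t s (_ ∷ fut) refl st s∈t with split s t | split-decomposes s t | searched-on-path s t st s∈t
  ... | []     , H | _     | ()
  ... | y ∷ ys , H | w , _ | s∈P =
    ⊎-map (fill-root _ H) (fill-root _ H)
          (arrange-root d (length ys) y ys (suc s) fut (predecessor-of-suc sP s∈P))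
    where
    sP : Sorted (y ∷ ys)
    sP = sorted-⊆ (path-⊆ (y ∷ ys) H) (subst Sorted (sym w) st)

leftmost-head : ∀ t → leftmost t ≡ head (inorder t)
leftmost-head leaf                     = refl
leftmost-head (node leaf k r)          = refl
leftmost-head (node l@(node a b c) k r) = trans (leftmost-head l) (head-++ (inorder a))
  where
  head-++ : ∀ xs → head (xs ++ b ∷ inorder c) ≡ head ((xs ++ b ∷ inorder c) ++ k ∷ inorder r)
  head-++ []      = refl
  head-++ (_ ∷ _) = refl

successor-leftmost-right : ∀ t {s} → Sorted (inorder t) → root t ≡ just s → suc s ∈ inorder t →
                           leftmost (rightSubtree t) ≡ just (suc s)
successor-leftmost-right (node l k r) st refl s+1∈t =
  trans (leftmost-head r)
        (successor-first (inorder r) sortedʳ boundʳ (∈-right-of (inorder l) (inorder r) boundˡ ≤-refl s+1∈t))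
  where open SortedAround (sorted-around (inorder l) st)

fromAfter-head : ∀ a k → 0 < k → head (fromAfter a k) ≡ just (suc a)
fromAfter-head a (suc k) _ = cong (λ m → just (suc m)) (+-identityʳ a)

-- The theorem.  T_{i-1} arises by searching s = i-1 in T_{i-2} with next
-- search i; (b) puts i or s at the root, and in the latter case the
-- invariant (a) puts i leftmost in the right subtree.

lemma5 : (d : List ℕ → Tree) → (∀ xs → inorder (d xs) ≡ xs) →
         (n : ℕ) (T0 : Tree) → IsBSTOn n T0 →
         (i : ℕ) → 1 < i → i ≤ n →
         root (GF d n T0 (i ∸ 1)) ≡ just i
         ⊎ (root (GF d n T0 (i ∸ 1)) ≡ just (i ∸ 1)
            × leftmost (rightSubtree (GF d n T0 (i ∸ 1))) ≡ just i)
lemma5 d d-inorder n T0 T0-bst (suc (suc m)) (s≤s (s≤s z≤n)) i≤n =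
  ⊎-map id (λ root≡s → root≡s , successor-leftmost-right (tree (suc m)) (sorted (suc m)) root≡s (key∈ (suc m) i≤n))
        (gfStep-root d (tree m) (suc m) _ (fromAfter-head (suc m) _ (m<n⇒0<n∸m i≤n))
                     (sorted m) (key∈ m (<⇒≤ i≤n)))
  where
  tree : ℕ → Tree
  tree = GF d n T0
  sorted : ∀ j → Sorted (inorder (tree j))
  sorted j = bst-sorted (tree j) (GF-inorder d d-inorder n T0 T0-bst j)
  key∈ : ∀ j {k} → k < n → suc k ∈ inorder (tree j)
  key∈ j k<n = subst (_ ∈_) (sym (GF-inorder d d-inorder n T0 T0-bst j)) (∈-applyUpTo⁺ _ k<n)
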